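{- For every nonempty partition $\mu$, \[ |\mu^r|-|\mu|+|\mu^c|-|\mu^{rc}|=-1. \]
   Context: $|\lambda|$ is the size of a partition. For a partition $\lambda$ set $\lambda_t=0$ for $t>\ell(\lambda)$. The Maya diagram of $\lambda$ is $S(\lambda)=\{\lambda_t-t+\tfrac12:t\ge1\}$. For $S\subseteq\mathbb{Z}+\tfrac12$ let $S^+=\{x\in S:x>0\}$, $S^-=\{x\in(\mathbb{Z}+\tfrac12)\setminus S:x<0\}$; if finite, $c(S)=|S^+|-|S^-|$ and $\{s-c(S):s\in S\}$ is the Maya diagram of a unique partition, the partition associated to $S$. For nonempty $\mu$ with $S=S(\mu)$: $\mu^r$ is the partition associated to $S\setminus\{\min S^+\}$, $\mu^c$ the partition associated to $S\cup\{\max S^-\}$, and $\mu^{rc}$ the partition associated to $(S\setminus\{\min S^+\})\cup\{\max S^-\}$. -}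

module Defs where

open import Level using (0ℓ)
open import Data.Nat using (ℕ; zero; suc; _≥_; _<_)
open import Data.Integer using (ℤ; +_; _-_; _+_; _≤_; 0ℤ; -1ℤ)
import Data.Integer as ℤ
open import Data.List using (List; []; _∷_; length)
open import Data.Nat.ListAction using (sum)
open import Data.List.Relation.Unary.All using (All)
open import Data.List.Relation.Unary.Linked using (Linked)
open import Data.List.Relation.Unary.Unique.Propositional using (Unique)
open import Data.List.Membership.Propositional using (_∈_)
open import Data.Product using (Σ; ∃; ∃-syntax; _×_)
open import Data.Sum using (_⊎_)
open import Function.Bundles using (_⇔_)
open import Relation.Binary.PropositionalEquality using (_≡_; _≢_)
open import Relation.Nullary using (¬_)
open import Relation.Unary using (Pred)

IsPartition : List ℕ → Set
IsPartition xs = Linked _≥_ xs × All (λ x → 0 < x) xs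

size : List ℕ → ℕ
size = sum

-- part λ i = λ_{i+1}, with λ_t = 0 for t > ℓ(λ)
part : List ℕ → ℕ → ℕ
part []       _       = 0
part (x ∷ xs) zero    = x
part (x ∷ xs) (suc i) = part xs i

-- Half-integers: the integer k encodes k + 1/2.
-- So x > 0 ⇔ k ≥ 0, x < 0 ⇔ k < 0, and x - c is encoded by k - c.
HSet : Set₁
HSet = Pred ℤ 0ℓ

-- Maya diagram S(λ) = { λ_t - t + 1/2 : t ≥ 1 }   (t = i + 1)
Maya : List ℕ → HSet
Maya la k = ∃[ i ] (k ≡ + part la i - + suc i)

Pos : HSet → HSet
Pos S k = S k × 0ℤ ≤ k

Neg : HSet → HSet
Neg S k = ¬ S k × k ℤ.< 0ℤ

HasCard : HSet → ℕ → Set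
HasCard P n = Σ (List ℤ) λ xs → Unique xs × (∀ x → (x ∈ xs) ⇔ P x) × length xs ≡ n

-- λ is the partition associated to S: S⁺, S⁻ finite, c(S) = |S⁺| - |S⁻|,
-- and S(λ) = { s - c(S) : s ∈ S }, i.e. k ∈ S(λ) ⇔ k + c(S) ∈ S.
AssocPartition : HSet → List ℕ → Set
AssocPartition S la =
  IsPartition la ×
  Σ ℕ λ p → Σ ℕ λ n → HasCard (Pos S) p × HasCard (Neg S) n ×
    (∀ k → Maya la k ⇔ S (k + (+ p - + n)))

IsMinPos : HSet → ℤ → Set
IsMinPos S m = Pos S m × (∀ x → Pos S x → m ≤ x)

IsMaxNeg : HSet → ℤ → Set
IsMaxNeg S m = Neg S m × (∀ x → Neg S x → x ≤ m)

remove : HSet → ℤ → HSet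
remove S m k = S k × k ≢ m

insert : HSet → ℤ → HSet
insert S m k = S k ⊎ k ≡ m

RC-Data : List ℕ → ℤ → ℤ → List ℕ → List ℕ → List ℕ → Set
RC-Data μ m₁ m₂ r c rc =
  IsMinPos (Maya μ) m₁ × IsMaxNeg (Maya μ) m₂ ×
  AssocPartition (remove (Maya μ) m₁) r ×
  AssocPartition (insert (Maya μ) m₂) c ×
  AssocPartition (insert (remove (Maya μ) m₁) m₂) rc

module Submission where

-- A set S of half-integers with S⁺ and S⁻ finite is coded by a binary
-- word with a cut in it: the letters before the cut decide membership of the
-- positive half-integers, those after it membership of the negative ones.  Read
-- as the boundary of a Young diagram, the word gives the partition associated
-- to S, whose size is the number of inversions (a true before a false) of the
-- word.  For S = S(μ), min S⁺ and max S⁻ are the last true before the cut and the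
-- first false after it, so μ^r, μ^c and μ^{rc} come from flipping one or both of
-- these two letters.  Each flip changes the inversion count independently of the
-- other, except for the pair formed by the two letters, which is an inversion
-- in μ only; this pair accounts for the -1.

open import Data.Bool using (Bool; true; false)
open import Data.Empty using (⊥; ⊥-elim)
open import Data.Integer as ℤ using (ℤ; +_; -[1+_]; _+_; _-_; 0ℤ; 1ℤ; -1ℤ; -<+; +<+; +≤+; -≤-)
import Data.Integer.Properties as ℤ
open import Data.Integer.Tactic.RingSolver using (solve-∀)
open import Data.List using (List; []; _∷_; _++_; length; replicate; map; take; drop)
open import Data.List.Membership.Propositional using (_∈_)
open import Data.List.Membership.Propositional.Properties using (∈-map⁺; ∈-map⁻)
open import Data.List.Membership.Propositional.Properties.WithK using (unique∧set⇒bag)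
open import Data.List.Properties
  using (length-map; length-++; length-replicate; ++-assoc; length-take; take++drop≡id)
open import Data.List.Relation.Binary.BagAndSetEquality using (∼bag⇒↭)
open import Data.List.Relation.Binary.Permutation.Propositional.Properties using (↭-length)
open import Data.List.Relation.Unary.All as All using (All; []; _∷_)
open import Data.List.Relation.Unary.AllPairs using ([]; _∷_)
open import Data.List.Relation.Unary.Any using (here; there)
open import Data.List.Relation.Unary.Linked using (Linked; []; [-]; _∷_)
open import Data.List.Relation.Unary.Unique.Propositional using (Unique)
import Data.List.Relation.Unary.Unique.Propositional.Properties as Unique
open import Data.Nat as ℕ using (ℕ; zero; suc; _∸_; z≤n; s≤s)
import Data.Nat.Properties as ℕ
import Data.Nat.Tactic.RingSolver as ℕ-Solver
open import Data.Product using (_×_; _,_; proj₁; ∃-syntax)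
open import Data.Product.Function.NonDependent.Propositional using (_×-⇔_)
open import Data.Sum using (_⊎_; inj₁; inj₂; [_,_]; assocˡ; assocʳ)
open import Data.Sum.Function.Propositional using (_⊎-⇔_)
open import Function using (id; _∘_; case_of_)
open import Function.Bundles using (_⇔_; mk⇔; Equivalence)
import Function.Properties.Equivalence as ⇔
open import Function.Related.Propositional using (module EquationalReasoning)
open import Function.Related.TypeIsomorphisms using (⊎-assoc; ¬-cong-⇔)
open import Relation.Binary.PropositionalEquality
  using (_≡_; _≢_; refl; sym; trans; cong; cong₂; subst; subst₂)
import Relation.Binary.PropositionalEquality as ≡
open import Relation.Nullary using (¬_; yes; no)

open import Defs

open Equivalence using (to; from)


-- ℤ.suc and ℤ.pred, defined by cases so that they compute on constructors.
suc′ : ℤ → ℤ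
suc′ (+ n)        = + suc n
suc′ -[1+ zero ]  = + 0
suc′ -[1+ suc n ] = -[1+ n ]

pred′ : ℤ → ℤ
pred′ (+ zero)  = -1ℤ
pred′ (+ suc n) = + n
pred′ -[1+ n ]  = -[1+ suc n ]

suc′≡+1 : ∀ k → suc′ k ≡ k + 1ℤ
suc′≡+1 (+ n)         = cong +_ (ℕ.+-comm 1 n)
suc′≡+1 -[1+ zero ]   = refl
suc′≡+1 -[1+ suc n ]  = refl

suc′-pred′ : ∀ k → suc′ (pred′ k) ≡ k
suc′-pred′ (+ zero)  = refl
suc′-pred′ (+ suc n) = refl
suc′-pred′ -[1+ n ]  = refl

pred′-suc′ : ∀ k → pred′ (suc′ k) ≡ k
pred′-suc′ (+ n)         = refl
pred′-suc′ -[1+ zero ]   = refl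
pred′-suc′ -[1+ suc n ]  = refl

suc′-injective : ∀ {j k} → suc′ j ≡ suc′ k → j ≡ k
suc′-injective {j} {k} eq = trans (sym (pred′-suc′ j)) (trans (cong pred′ eq) (pred′-suc′ k))

pred′-injective : ∀ {j k} → pred′ j ≡ pred′ k → j ≡ k
pred′-injective {j} {k} eq = trans (sym (suc′-pred′ j)) (trans (cong suc′ eq) (suc′-pred′ k))

suc′-minus : ∀ k j → suc′ (k - j) ≡ suc′ k - j
suc′-minus k j = trans (suc′≡+1 (k - j)) (trans (+1-minus k j) (cong (_- j) (sym (suc′≡+1 k))))
  where
  +1-minus : ∀ k j → k - j + 1ℤ ≡ k + 1ℤ - j
  +1-minus = solve-∀

suc′-minus-suc : ∀ k j → suc′ (k - (1ℤ + j)) ≡ k - j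
suc′-minus-suc k j = trans (suc′≡+1 _) (+1-cancel k j)
  where
  +1-cancel : ∀ k j → k - (1ℤ + j) + 1ℤ ≡ k - j
  +1-cancel = solve-∀

suc′≡⇔ : ∀ k j → (suc′ k ≡ j) ⇔ (k ≡ pred′ j)
suc′≡⇔ k j = mk⇔ (λ { refl → sym (pred′-suc′ k) }) (λ { refl → suc′-pred′ j })

minus≡⇔ : ∀ k j i → (k - j ≡ i) ⇔ (k ≡ i + j)
minus≡⇔ k j i = mk⇔ (λ { refl → add-back k j }) (λ { refl → cancel i j })
  where
  add-back : ∀ k j → k ≡ k - j + j
  add-back = solve-∀
  cancel : ∀ i j → i + j - j ≡ i
  cancel = solve-∀

alternating-sum≡-1 : ∀ {p q r s} → p ℕ.+ r ℕ.+ 1 ≡ q ℕ.+ s → + p - + q + + r - + s ≡ -1ℤ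
alternating-sum≡-1 {p} {q} {r} {s} eq = begin
  + p - + q + + r - + s                  ≡⟨ rearrange (+ p) (+ q) (+ r) (+ s) ⟩
  (+ p + + r + 1ℤ) - (+ q + + s) - 1ℤ   ≡⟨ cong (λ t → t - (+ q + + s) - 1ℤ) p+r+1≡q+s ⟩
  (+ q + + s) - (+ q + + s) - 1ℤ         ≡⟨ cancel (+ q + + s) ⟩
  -1ℤ                                    ∎
  where
  open ≡.≡-Reasoning
  rearrange : ∀ p q r s → p - q + r - s ≡ (p + r + 1ℤ) - (q + s) - 1ℤ
  rearrange = solve-∀
  cancel : ∀ t → t - t - 1ℤ ≡ -1ℤ
  cancel = solve-∀
  p+r+1≡q+s : + p + + r + 1ℤ ≡ + q + + s
  p+r+1≡q+s = begin
    + p + + r + 1ℤ        ≡⟨ cong (_+ 1ℤ) (ℤ.pos-+ p r) ⟨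
    + (p ℕ.+ r) + 1ℤ      ≡⟨ ℤ.pos-+ (p ℕ.+ r) 1 ⟨
    + (p ℕ.+ r ℕ.+ 1)     ≡⟨ cong +_ eq ⟩
    + (q ℕ.+ s)           ≡⟨ ℤ.pos-+ q s ⟩
    + q + + s             ∎


infix 4 _≐_
_≐_ : HSet → HSet → Set
S ≐ T = ∀ k → S k ⇔ T k

≐-sym : ∀ {S T} → S ≐ T → T ≐ S
≐-sym eq k = ⇔.sym (eq k)

≐-trans : ∀ {S T U} → S ≐ T → T ≐ U → S ≐ U
≐-trans eq eq′ k = ⇔.trans (eq k) (eq′ k)

insert-cong : ∀ {S T} m → S ≐ T → insert S m ≐ insert T m
insert-cong m S≐T k = S≐T k ⊎-⇔ ⇔.refl

remove-cong : ∀ {S T} m → S ≐ T → remove S m ≐ remove T m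
remove-cong m S≐T k = S≐T k ×-⇔ ⇔.refl

remove-insert : ∀ {S m} → ¬ S m → remove (insert S m) m ≐ S
remove-insert m∉S k = mk⇔
  (λ { (inj₁ k∈S , _) → k∈S ; (inj₂ k≡m , k≢m) → ⊥-elim (k≢m k≡m) })
  (λ k∈S → inj₁ k∈S , λ { refl → m∉S k∈S })

Pos-resp : ∀ {S T} → S ≐ T → Pos S ≐ Pos T
Pos-resp S≐T k = S≐T k ×-⇔ ⇔.refl

Neg-resp : ∀ {S T} → S ≐ T → Neg S ≐ Neg T
Neg-resp S≐T k = ¬-cong-⇔ (S≐T k) ×-⇔ ⇔.refl

IsMinPos-resp : ∀ {S T m} → S ≐ T → IsMinPos S m → IsMinPos T m
IsMinPos-resp S≐T (m∈ , m≤) = to (Pos-resp S≐T _) m∈ , λ x x∈ → m≤ x (from (Pos-resp S≐T x) x∈)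

IsMaxNeg-resp : ∀ {S T m} → S ≐ T → IsMaxNeg S m → IsMaxNeg T m
IsMaxNeg-resp S≐T (m∈ , ≤m) = to (Neg-resp S≐T _) m∈ , λ x x∈ → ≤m x (from (Neg-resp S≐T x) x∈)

IsMinPos-unique : ∀ {S m m′} → IsMinPos S m → IsMinPos S m′ → m ≡ m′
IsMinPos-unique (m∈ , m≤) (m′∈ , m′≤) = ℤ.≤-antisym (m≤ _ m′∈) (m′≤ _ m∈)

IsMaxNeg-unique : ∀ {S m m′} → IsMaxNeg S m → IsMaxNeg S m′ → m ≡ m′
IsMaxNeg-unique (m∈ , ≤m) (m′∈ , ≤m′) = ℤ.≤-antisym (≤m′ _ m∈) (≤m _ m′∈)

HasCard-resp : ∀ {P Q : HSet} {n} → P ≐ Q → HasCard P n → HasCard Q n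
HasCard-resp P≐Q (xs , xs! , ∈xs⇔ , len) = xs , xs! , (λ x → ⇔.trans (∈xs⇔ x) (P≐Q x)) , len

HasCard-unique : ∀ {P : HSet} {m n} → HasCard P m → HasCard P n → m ≡ n
HasCard-unique (xs , xs! , ∈xs⇔ , refl) (ys , ys! , ∈ys⇔ , refl) =
  ↭-length (∼bag⇒↭ (unique∧set⇒bag xs! ys! λ {x} → ⇔.trans (∈xs⇔ x) (⇔.sym (∈ys⇔ x))))


-- Maya diagrams

Maya-[] : ∀ k → Maya [] k ⇔ k ℤ.< 0ℤ
Maya-[] k = mk⇔ (λ { (i , refl) → -<+ }) λ { -<+ → _ , refl }

Maya-∷ : ∀ x xs k → Maya (x ∷ xs) k ⇔ ((k ≡ + x - 1ℤ) ⊎ Maya xs (suc′ k))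
Maya-∷ x xs k = mk⇔
  (λ { (zero , k≡) → inj₁ k≡
     ; (suc i , k≡) → inj₂ (i , trans (cong suc′ k≡) (suc′-minus-suc (+ part xs i) (+ suc i))) })
  (λ { (inj₁ k≡) → zero , k≡
     ; (inj₂ (i , k+1≡)) →
         suc i , suc′-injective (trans k+1≡ (sym (suc′-minus-suc (+ part xs i) (+ suc i)))) })

Maya-cong : ∀ {xs ys} → (∀ i → part xs i ≡ part ys i) → Maya xs ≐ Maya ys
Maya-cong eq k = mk⇔
  (λ { (i , k≡) → i , trans k≡ (cong (λ p → + p - + suc i) (eq i)) })
  (λ { (i , k≡) → i , trans k≡ (cong (λ p → + p - + suc i) (sym (eq i))) })

Maya-pred′ : ∀ x xs {k} → Maya xs k → Maya (x ∷ xs) (pred′ k)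
Maya-pred′ x xs {k} k∈ = from (Maya-∷ x xs (pred′ k)) (inj₂ (subst (Maya xs) (sym (suc′-pred′ k)) k∈))

IsPartition-tail : ∀ {x xs} → IsPartition (x ∷ xs) → IsPartition xs
IsPartition-tail ([-]    , _ ∷ positive) = [] , positive
IsPartition-tail (_ ∷ xs , _ ∷ positive) = xs , positive

IsPartition-head≥ : ∀ {x xs} → IsPartition (x ∷ xs) → part xs 0 ℕ.≤ x
IsPartition-head≥ {xs = []} _     = z≤n
IsPartition-head≥ (x≥ ∷ _ , _)   = x≥

part≤head : ∀ xs → IsPartition xs → ∀ i → part xs i ℕ.≤ part xs 0
part≤head []       _ i       = z≤n
part≤head (x ∷ xs) _ zero    = ℕ.≤-refl
part≤head (x ∷ xs) p (suc i) =
  ℕ.≤-trans (part≤head xs (IsPartition-tail p) i) (IsPartition-head≥ p)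

Maya-<-head : ∀ xs → IsPartition xs → ∀ {k} → Maya xs k → k ℤ.< + part xs 0
Maya-<-head xs p (i , refl) = ℤ.<-≤-trans (ℤ.m⊖1+n<m (part xs i) (suc i)) (+≤+ (part≤head xs p i))

Maya-head-≤ : ∀ {x xs y ys} → IsPartition (x ∷ xs) → IsPartition (y ∷ ys) →
  (∀ k → Maya (x ∷ xs) k → Maya (y ∷ ys) k) → x ℕ.≤ y
Maya-head-≤ (_ , s≤s z≤n ∷ _) pys ⊆ with Maya-<-head _ pys (⊆ _ (zero , refl))
... | +<+ x≤y = x≤y

Maya-tail-⊆ : ∀ {x xs ys} → IsPartition (x ∷ xs) →
  (∀ k → Maya (x ∷ xs) k → Maya (x ∷ ys) k) → ∀ k → Maya xs k → Maya ys k
Maya-tail-⊆ {zero}          (_ , () ∷ _) _ _ _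
Maya-tail-⊆ {suc x} {xs} {ys} pxs ⊆ k k∈xs
  with to (Maya-∷ (suc x) ys (pred′ k)) (⊆ (pred′ k) (Maya-pred′ (suc x) xs k∈xs))
... | inj₂ k∈ys    = subst (Maya ys) (suc′-pred′ k) k∈ys
... | inj₁ k-1≡x-1 = ⊥-elim (ℤ.<-irrefl k≡x (ℤ.<-≤-trans k<head (+≤+ (IsPartition-head≥ pxs))))
  where
  k≡x : k ≡ + suc x
  k≡x = trans (sym (suc′-pred′ k)) (cong suc′ k-1≡x-1)
  k<head : k ℤ.< + part xs 0
  k<head = Maya-<-head xs (IsPartition-tail pxs) k∈xs

Maya-injective : ∀ {xs ys} → IsPartition xs → IsPartition ys → Maya xs ≐ Maya ys → xs ≡ ys
Maya-injective {[]}    {[]}    _ _ _ = refl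
Maya-injective {[]}    {_ ∷ _} _ (_ , s≤s z≤n ∷ _) xs≐ys with from (xs≐ys _) (zero , refl)
... | _ , ()
Maya-injective {_ ∷ _} {[]}    (_ , s≤s z≤n ∷ _) _ xs≐ys with to (xs≐ys _) (zero , refl)
... | _ , ()
Maya-injective {x ∷ xs} {y ∷ ys} pxs pys xs≐ys
  with ℕ.≤-antisym (Maya-head-≤ pxs pys (to ∘ xs≐ys)) (Maya-head-≤ pys pxs (from ∘ xs≐ys))
... | refl = cong (x ∷_) (Maya-injective (IsPartition-tail pxs) (IsPartition-tail pys) tails)
  where
  tails : Maya xs ≐ Maya ys
  tails k = mk⇔ (Maya-tail-⊆ pxs (to ∘ xs≐ys) k) (Maya-tail-⊆ pys (from ∘ xs≐ys) k)

AssocPartition-unique : ∀ {S la la′} → AssocPartition S la → AssocPartition S la′ → la ≡ la′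
AssocPartition-unique (p , _ , _ , #pos , #neg , la≐) (p′ , _ , _ , #pos′ , #neg′ , la′≐)
  with HasCard-unique #pos #pos′ | HasCard-unique #neg #neg′
... | refl | refl = Maya-injective p p′ λ k → ⇔.trans (la≐ k) (⇔.sym (la′≐ k))

AssocPartition-resp : ∀ {S T la} → S ≐ T → AssocPartition S la → AssocPartition T la
AssocPartition-resp S≐T (p , np , nn , #pos , #neg , la≐) =
  p , np , nn , HasCard-resp (Pos-resp S≐T) #pos , HasCard-resp (Neg-resp S≐T) #neg ,
  λ k → ⇔.trans (la≐ k) (S≐T _)


#false : List Bool → ℕ
#false []          = 0
#false (false ∷ w) = suc (#false w)
#false (true ∷ w)  = #false w

#true : List Bool → ℕ
#true []          = 0
#true (false ∷ w) = #true w
#true (true ∷ w)  = suc (#true w)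

inversions : List Bool → ℕ
inversions []          = 0
inversions (false ∷ w) = inversions w
inversions (true ∷ w)  = #false w ℕ.+ inversions w

falses trues : ℕ → List Bool
falses n = replicate n false
trues n = replicate n true

#false-++ : ∀ u v → #false (u ++ v) ≡ #false u ℕ.+ #false v
#false-++ []          v = refl
#false-++ (false ∷ u) v = cong suc (#false-++ u v)
#false-++ (true ∷ u)  v = #false-++ u v

#false-falses : ∀ n → #false (falses n) ≡ n
#false-falses zero    = refl
#false-falses (suc n) = cong suc (#false-falses n)

#true-falses : ∀ n → #true (falses n) ≡ 0
#true-falses zero    = refl
#true-falses (suc n) = #true-falses n

#false-trues : ∀ n → #false (trues n) ≡ 0
#false-trues zero    = refl
#false-trues (suc n) = #false-trues n

length≡#true+#false : ∀ w → length w ≡ #true w ℕ.+ #false w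
length≡#true+#false []          = refl
length≡#true+#false (true ∷ w)  = cong suc (length≡#true+#false w)
length≡#true+#false (false ∷ w) =
  trans (cong suc (length≡#true+#false w)) (sym (ℕ.+-suc (#true w) (#false w)))

#false≤length : ∀ w → #false w ℕ.≤ length w
#false≤length w = subst (#false w ℕ.≤_) (sym (length≡#true+#false w)) (ℕ.m≤n+m (#false w) (#true w))

inversions-++ : ∀ u v → inversions (u ++ v) ≡ inversions u ℕ.+ #true u ℕ.* #false v ℕ.+ inversions v
inversions-++ []          v = refl
inversions-++ (false ∷ u) v = inversions-++ u v
inversions-++ (true ∷ u)  v
  rewrite #false-++ u v | inversions-++ u v
  = rearrange (#false u) (#false v) (inversions u) (#true u) (inversions v)
  where
  rearrange : ∀ fu fv iu tu iv →
    fu ℕ.+ fv ℕ.+ (iu ℕ.+ tu ℕ.* fv ℕ.+ iv) ≡ fu ℕ.+ iu ℕ.+ (fv ℕ.+ tu ℕ.* fv) ℕ.+ iv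
  rearrange = ℕ-Solver.solve-∀

inversions-exchange : ∀ x y z →
  inversions (x ++ false ∷ y ++ false ∷ z) ℕ.+ inversions (x ++ true ∷ y ++ true ∷ z) ℕ.+ 1
    ≡ inversions (x ++ true ∷ y ++ false ∷ z) ℕ.+ inversions (x ++ false ∷ y ++ true ∷ z)
inversions-exchange x y z
  rewrite inversions-++ x (false ∷ y ++ false ∷ z) | inversions-++ x (true ∷ y ++ true ∷ z)
        | inversions-++ x (true ∷ y ++ false ∷ z) | inversions-++ x (false ∷ y ++ true ∷ z)
        | #false-++ y (false ∷ z) | #false-++ y (true ∷ z)
        | inversions-++ y (false ∷ z) | inversions-++ y (true ∷ z)
  = identity (inversions x) (#true x) (#false y) (#false z) (inversions y) (#true y) (inversions z)
  where
  identity : ∀ ix tx fy fz iy ty iz →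
    ix ℕ.+ tx ℕ.* suc (fy ℕ.+ suc fz) ℕ.+ (iy ℕ.+ ty ℕ.* suc fz ℕ.+ iz)
      ℕ.+ (ix ℕ.+ tx ℕ.* (fy ℕ.+ fz) ℕ.+ (fy ℕ.+ fz ℕ.+ (iy ℕ.+ ty ℕ.* fz ℕ.+ (fz ℕ.+ iz)))) ℕ.+ 1
    ≡ ix ℕ.+ tx ℕ.* (fy ℕ.+ suc fz) ℕ.+ (fy ℕ.+ suc fz ℕ.+ (iy ℕ.+ ty ℕ.* suc fz ℕ.+ iz))
      ℕ.+ (ix ℕ.+ tx ℕ.* suc (fy ℕ.+ fz) ℕ.+ (iy ℕ.+ ty ℕ.* fz ℕ.+ (fz ℕ.+ iz)))
  identity = ℕ-Solver.solve-∀


-- Sets coded by words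

-- The word u ++ v, with a cut between u and v, codes a set of half-integers:
-- counting from 0 at the cut, the i-th letter of u decides whether i + ½ belongs
-- to it, the i-th letter of v whether -i - ½ does, and every x < -|v| belongs to it.
Below : List Bool → HSet
Below []      k = k ℤ.< 0ℤ
Below (b ∷ w) k = (k ≡ -1ℤ × b ≡ true) ⊎ Below w (suc′ k)

Above : List Bool → HSet
Above []      k = ⊥
Above (b ∷ u) k = (k ≡ + length u × b ≡ true) ⊎ Above u k

Cut : List Bool → List Bool → HSet
Cut u v k = Above u k ⊎ Below v k

Below-negative : ∀ w {k} → Below w k → k ℤ.< 0ℤ
Below-negative []      k<0                   = k<0
Below-negative (b ∷ w) (inj₁ (refl , _))     = -<+
Below-negative (b ∷ w) {+ n} (inj₂ k+1∈w) with Below-negative w k+1∈w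
... | +<+ ()
Below-negative (b ∷ w) { -[1+ n ]} (inj₂ _) = -<+

Above-bounded : ∀ u {k} → Above u k → ∃[ m ] k ≡ + m × m ℕ.< length u
Above-bounded (b ∷ u) (inj₁ (refl , _)) = length u , refl , ℕ.≤-refl
Above-bounded (b ∷ u) (inj₂ k∈u) with Above-bounded u k∈u
... | m , k≡m , m<u = m , k≡m , ℕ.m≤n⇒m≤1+n m<u

Above-nonnegative : ∀ u {k} → Above u k → 0ℤ ℤ.≤ k
Above-nonnegative u k∈u with Above-bounded u k∈u
... | m , refl , _ = +≤+ z≤n

Above-falses : ∀ a {k} → ¬ Above (falses a) k
Above-falses (suc a) (inj₁ (_ , ()))
Above-falses (suc a) (inj₂ k∈) = Above-falses a k∈

Above-length-∉ : ∀ y → ¬ Above y (+ length y)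
Above-length-∉ y y∈ with Above-bounded y y∈
... | m , y≡m , m<y = ℕ.<-irrefl (sym (ℤ.+-injective y≡m)) m<y

Above-++-lower : ∀ α y {k} → Above (α ++ y) k → Above y k ⊎ + length y ℤ.≤ k
Above-++-lower []      y k∈                 = inj₁ k∈
Above-++-lower (c ∷ α) y (inj₁ (refl , _)) =
  inj₂ (+≤+ (subst (length y ℕ.≤_) (sym (length-++ α)) (ℕ.m≤n+m (length y) (length α))))
Above-++-lower (c ∷ α) y (inj₂ k∈)        = Above-++-lower α y k∈

Below-++ : ∀ u v k → Below (u ++ v) (k - + length u) ⇔ Cut u v k
Below-++ []      v k =
  subst (λ j → Below v j ⇔ Cut [] v k) (sym (ℤ.+-identityʳ k)) (mk⇔ inj₂ [ ⊥-elim , id ])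
Below-++ (b ∷ u) v k = begin
  ((k - + suc n ≡ -1ℤ × b ≡ true) ⊎ Below (u ++ v) (suc′ (k - + suc n)))
    ≡⟨ cong (λ j → (k - + suc n ≡ -1ℤ × b ≡ true) ⊎ Below (u ++ v) j) (suc′-minus-suc k (+ n)) ⟩
  ((k - + suc n ≡ -1ℤ × b ≡ true) ⊎ Below (u ++ v) (k - + n))
    ∼⟨ (minus≡⇔ k (+ suc n) -1ℤ ×-⇔ ⇔.refl) ⊎-⇔ Below-++ u v k ⟩
  ((k ≡ + n × b ≡ true) ⊎ (Above u k ⊎ Below v k))
    ↔⟨ ⊎-assoc _ _ _ _ ⟨
  Cut (b ∷ u) v k
    ∎
  where
  n = length u
  open EquationalReasoning

positives : List Bool → List ℤ
positives []          = []
positives (false ∷ u) = positives u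
positives (true ∷ u)  = + length u ∷ positives u

∈-positives⇔ : ∀ u x → (x ∈ positives u) ⇔ Above u x
∈-positives⇔ []          x = mk⇔ (λ ()) (λ ())
∈-positives⇔ (false ∷ u) x = ⇔.trans (∈-positives⇔ u x) (mk⇔ inj₂ [ (λ { (_ , ()) }) , id ])
∈-positives⇔ (true ∷ u)  x = mk⇔
  (λ { (here refl) → inj₁ (refl , refl) ; (there x∈) → inj₂ (to (∈-positives⇔ u x) x∈) })
  (λ { (inj₁ (refl , _)) → here refl ; (inj₂ x∈u) → there (from (∈-positives⇔ u x) x∈u) })

positives-unique : ∀ u → Unique (positives u)
positives-unique []          = []
positives-unique (false ∷ u) = positives-unique u
positives-unique (true ∷ u)  = All.tabulate length≢ ∷ positives-unique u
  where
  length≢ : ∀ {x} → x ∈ positives u → + length u ≢ x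
  length≢ {x} x∈ refl with Above-bounded u (to (∈-positives⇔ u x) x∈)
  ... | m , u≡m , m<u = ℕ.<-irrefl (sym (ℤ.+-injective u≡m)) m<u

length-positives : ∀ u → length (positives u) ≡ #true u
length-positives []          = refl
length-positives (false ∷ u) = length-positives u
length-positives (true ∷ u)  = cong suc (length-positives u)

holes : List Bool → List ℤ
holes []          = []
holes (false ∷ v) = -1ℤ ∷ map pred′ (holes v)
holes (true ∷ v)  = map pred′ (holes v)

∈-holes⇔ : ∀ v x → (x ∈ holes v) ⇔ Neg (Below v) x
∈-holes⇔ []      x = mk⇔ (λ ()) (λ { (x∉ , x<0) → ⊥-elim (x∉ x<0) })
∈-holes⇔ (b ∷ v) x = mk⇔ (into b) (onto b x)
  where
  shifted : ∀ {b x} → x ∈ map pred′ (holes v) → Neg (Below (b ∷ v)) x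
  shifted x∈ with ∈-map⁻ pred′ x∈
  ... | y , y∈ , refl with to (∈-holes⇔ v y) y∈
  ... | y∉ , -<+ = [ (λ { (() , _) }) , y∉ ∘ subst (Below v) (suc′-pred′ _) ] , -<+
  into : ∀ b → x ∈ holes (b ∷ v) → Neg (Below (b ∷ v)) x
  into false (here refl) = [ (λ { (_ , ()) }) , (λ 0∈v → ℤ.<-irrefl refl (Below-negative v 0∈v)) ] , -<+
  into false (there x∈)  = shifted x∈
  into true  x∈          = shifted x∈
  unshifted : ∀ {b} n → Neg (Below (b ∷ v)) -[1+ suc n ] → -[1+ suc n ] ∈ map pred′ (holes v)
  unshifted n (x∉ , _) = ∈-map⁺ pred′ (from (∈-holes⇔ v -[1+ n ]) ((x∉ ∘ inj₂) , -<+))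
  onto : ∀ b x → Neg (Below (b ∷ v)) x → x ∈ holes (b ∷ v)
  onto b     (+ n)           (_ , +<+ ())
  onto false -[1+ zero ]     _          = here refl
  onto true  -[1+ zero ]     (x∉ , _)   = ⊥-elim (x∉ (inj₁ (refl , refl)))
  onto false -[1+ suc n ]    hole       = there (unshifted n hole)
  onto true  -[1+ suc n ]    hole       = unshifted n hole

holes-unique : ∀ v → Unique (holes v)
holes-unique []          = []
holes-unique (true ∷ v)  = Unique.map⁺ pred′-injective (holes-unique v)
holes-unique (false ∷ v) = All.tabulate -1≢ ∷ Unique.map⁺ pred′-injective (holes-unique v)
  where
  -1≢ : ∀ {x} → x ∈ map pred′ (holes v) → -1ℤ ≢ x
  -1≢ x∈ eq with ∈-map⁻ pred′ x∈
  ... | y , y∈ , refl with to (∈-holes⇔ v y) y∈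
  -1≢ x∈ () | -[1+ n ] , _ , refl | _ , -<+

length-holes : ∀ v → length (holes v) ≡ #false v
length-holes []          = refl
length-holes (true ∷ v)  = trans (length-map pred′ (holes v)) (length-holes v)
length-holes (false ∷ v) = cong suc (trans (length-map pred′ (holes v)) (length-holes v))

Pos-Cut : ∀ u v → Pos (Cut u v) ≐ Above u
Pos-Cut u v k = mk⇔
  (λ { (inj₁ k∈u , _) → k∈u ; (inj₂ k∈v , 0≤k) → ⊥-elim (ℤ.≤⇒≯ 0≤k (Below-negative v k∈v)) })
  (λ k∈u → inj₁ k∈u , Above-nonnegative u k∈u)

Neg-Cut : ∀ u v → Neg (Cut u v) ≐ Neg (Below v)
Neg-Cut u v k = mk⇔
  (λ { (k∉ , k<0) → k∉ ∘ inj₂ , k<0 })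
  (λ { (k∉v , k<0) → [ (λ k∈u → ℤ.≤⇒≯ (Above-nonnegative u k∈u) k<0) , k∉v ] , k<0 })

Above-flip : ∀ α y → Above (α ++ true ∷ y) ≐ insert (Above (α ++ false ∷ y)) (+ length y)
Above-flip []      y k = mk⇔
  (λ { (inj₁ (k≡ , _)) → inj₂ k≡ ; (inj₂ k∈) → inj₁ (inj₂ k∈) })
  (λ { (inj₁ (inj₁ (_ , ()))) ; (inj₁ (inj₂ k∈)) → inj₂ k∈ ; (inj₂ k≡) → inj₁ (k≡ , refl) })
Above-flip (c ∷ α) y k = begin
  ((k ≡ + length (α ++ true ∷ y) × c ≡ true) ⊎ Above (α ++ true ∷ y) k)
    ≡⟨ cong (λ n → (k ≡ + n × c ≡ true) ⊎ Above (α ++ true ∷ y) k)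
            (trans (length-++ α) (sym (length-++ α))) ⟩
  ((k ≡ + length (α ++ false ∷ y) × c ≡ true) ⊎ Above (α ++ true ∷ y) k)
    ∼⟨ ⇔.refl ⊎-⇔ Above-flip α y k ⟩
  ((k ≡ + length (α ++ false ∷ y) × c ≡ true) ⊎ (Above (α ++ false ∷ y) k ⊎ k ≡ + length y))
    ↔⟨ ⊎-assoc _ _ _ _ ⟨
  insert (Above (c ∷ α ++ false ∷ y)) (+ length y) k
    ∎
  where open EquationalReasoning

Above-flip-∉ : ∀ α y → ¬ Above (α ++ false ∷ y) (+ length y)
Above-flip-∉ α y y∈ with Above-++-lower α (false ∷ y) y∈
... | inj₁ (inj₁ (_ , ()))
... | inj₁ (inj₂ y∈′)    = Above-length-∉ y y∈′
... | inj₂ (+≤+ y<y)     = ℕ.<-irrefl refl y<y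

Below-flip : ∀ x β → Below (x ++ true ∷ β) ≐ insert (Below (x ++ false ∷ β)) -[1+ length x ]
Below-flip []      β k = mk⇔
  (λ { (inj₁ (k≡ , _)) → inj₂ k≡ ; (inj₂ k∈) → inj₁ (inj₂ k∈) })
  (λ { (inj₁ (inj₁ (_ , ()))) ; (inj₁ (inj₂ k∈)) → inj₂ k∈ ; (inj₂ k≡) → inj₁ (k≡ , refl) })
Below-flip (c ∷ x) β k = begin
  ((k ≡ -1ℤ × c ≡ true) ⊎ Below (x ++ true ∷ β) (suc′ k))
    ∼⟨ ⇔.refl ⊎-⇔ Below-flip x β (suc′ k) ⟩
  ((k ≡ -1ℤ × c ≡ true) ⊎ (Below (x ++ false ∷ β) (suc′ k) ⊎ suc′ k ≡ -[1+ length x ]))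
    ∼⟨ ⇔.refl ⊎-⇔ (⇔.refl ⊎-⇔ suc′≡⇔ k -[1+ length x ]) ⟩
  ((k ≡ -1ℤ × c ≡ true) ⊎ (Below (x ++ false ∷ β) (suc′ k) ⊎ k ≡ -[1+ suc (length x) ]))
    ↔⟨ ⊎-assoc _ _ _ _ ⟨
  insert (Below (c ∷ x ++ false ∷ β)) -[1+ length (c ∷ x) ] k
    ∎
  where open EquationalReasoning

Below-flip-∉ : ∀ x β → ¬ Below (x ++ false ∷ β) -[1+ length x ]
Below-flip-∉ []      β (inj₁ (_ , ()))
Below-flip-∉ []      β (inj₂ 0∈β) = ℤ.<-irrefl refl (Below-negative β 0∈β)
Below-flip-∉ (c ∷ x) β (inj₁ (() , _))
Below-flip-∉ (c ∷ x) β (inj₂ x∈)  = Below-flip-∉ x β x∈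

Below-trues : ∀ b w j → j ℕ.< b → Below (trues b ++ w) -[1+ j ]
Below-trues (suc b) w zero    _         = inj₁ (refl , refl)
Below-trues (suc b) w (suc j) (s≤s j<b) = inj₂ (Below-trues b w j j<b)


-- The partition of a word

-- Drops the tail along with a zero part; toPartition does so only when the tail is empty.
cons⁺ : ℕ → List ℕ → List ℕ
cons⁺ zero    _  = []
cons⁺ (suc n) xs = suc n ∷ xs

-- A word traces the boundary of a Young diagram from the top right to the bottom
-- left, true for a down step and false for a left step; each down step ends a row
-- whose length is the number of left steps still to come.
toPartition : List Bool → List ℕ
toPartition []          = []
toPartition (false ∷ w) = toPartition w
toPartition (true ∷ w)  = cons⁺ (#false w) (toPartition w)

toPartition-#false≡0 : ∀ w → #false w ≡ 0 → toPartition w ≡ []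
toPartition-#false≡0 []         _ = refl
toPartition-#false≡0 (true ∷ w) h rewrite h = refl

toPartition-bounded : ∀ w → All (ℕ._≤ #false w) (toPartition w)
toPartition-bounded []          = []
toPartition-bounded (false ∷ w) = All.map (λ p → ℕ.m≤n⇒m≤1+n p) (toPartition-bounded w)
toPartition-bounded (true ∷ w) with #false w | toPartition-bounded w
... | zero  | _       = []
... | suc n | bounded = ℕ.≤-refl ∷ bounded

toPartition-isPartition : ∀ w → IsPartition (toPartition w)
toPartition-isPartition []          = [] , []
toPartition-isPartition (false ∷ w) = toPartition-isPartition w
toPartition-isPartition (true ∷ w)
  with #false w | toPartition-bounded w | toPartition-isPartition w
... | zero  | _       | _                  = [] , []
... | suc n | bounded | decreasing , positive = linked bounded decreasing , s≤s z≤n ∷ positive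
  where
  linked : ∀ {x ys} → All (ℕ._≤ x) ys → Linked ℕ._≥_ ys → Linked ℕ._≥_ (x ∷ ys)
  linked []      _  = [-]
  linked (p ∷ _) ys = p ∷ ys

size-toPartition : ∀ w → size (toPartition w) ≡ inversions w
size-toPartition []          = refl
size-toPartition (false ∷ w) = size-toPartition w
size-toPartition (true ∷ w) with #false w in eq
... | zero  = trans (cong size (sym (toPartition-#false≡0 w eq))) (size-toPartition w)
... | suc n = cong (suc n ℕ.+_) (size-toPartition w)

Maya-cons⁺ : ∀ n xs → (n ≡ 0 → xs ≡ []) → Maya (cons⁺ n xs) ≐ Maya (n ∷ xs)
Maya-cons⁺ zero    xs h rewrite h refl = Maya-cong {[]} {0 ∷ []} λ { zero → refl ; (suc i) → refl }
Maya-cons⁺ (suc n) xs h k = ⇔.refl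

Maya-toPartition : ∀ w k → Maya (toPartition w) k ⇔ Below w (k - + #false w)
Maya-toPartition []          k =
  subst (λ j → Maya [] k ⇔ j ℤ.< 0ℤ) (sym (ℤ.+-identityʳ k)) (Maya-[] k)
Maya-toPartition (false ∷ w) k = begin
  Maya (toPartition w) k                         ∼⟨ Maya-toPartition w k ⟩
  Below w (k - + n)                              ≡⟨ cong (Below w) (sym (suc′-minus-suc k (+ n))) ⟩
  Below w (suc′ (k - + suc n))                   ∼⟨ mk⇔ inj₂ [ (λ { (_ , ()) }) , id ] ⟩
  Below (false ∷ w) (k - + suc n)                ∎
  where
  n = #false w
  open EquationalReasoning
Maya-toPartition (true ∷ w)  k = begin
  Maya (cons⁺ n (toPartition w)) k               ∼⟨ Maya-cons⁺ n _ (toPartition-#false≡0 w) k ⟩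
  Maya (n ∷ toPartition w) k                     ∼⟨ Maya-∷ n (toPartition w) k ⟩
  ((k ≡ + n - 1ℤ) ⊎ Maya (toPartition w) (suc′ k))
    ∼⟨ ⇔.trans (⇔.sym (minus≡⇔ k (+ n) -1ℤ)) (mk⇔ (_, refl) proj₁) ⊎-⇔ Maya-toPartition w (suc′ k) ⟩
  ((k - + n ≡ -1ℤ × true ≡ true) ⊎ Below w (suc′ k - + n))
    ≡⟨ cong (λ j → (k - + n ≡ -1ℤ × true ≡ true) ⊎ Below w j) (sym (suc′-minus k (+ n))) ⟩
  Below (true ∷ w) (k - + n)                     ∎
  where
  n = #false w
  open EquationalReasoning

-- The charge #true u - #false v of the cut is the shift c(S) of the associated partition.
Maya-toPartition-++ : ∀ u v k → Maya (toPartition (u ++ v)) k ⇔ Cut u v (k + (+ #true u - + #false v))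
Maya-toPartition-++ u v k = begin
  Maya (toPartition (u ++ v)) k                           ∼⟨ Maya-toPartition (u ++ v) k ⟩
  Below (u ++ v) (k - + #false (u ++ v))                  ≡⟨ cong (Below (u ++ v)) shift ⟩
  Below (u ++ v) (k + (+ #true u - + #false v) - + length u) ∼⟨ Below-++ u v _ ⟩
  Cut u v (k + (+ #true u - + #false v))                  ∎
  where
  open EquationalReasoning
  rearrange : ∀ k t fu fv → k - (fu + fv) ≡ k + (t - fv) - (t + fu)
  rearrange = solve-∀
  shift : k - + #false (u ++ v) ≡ k + (+ #true u - + #false v) - + length u
  shift rewrite #false-++ u v | length≡#true+#false u
              | ℤ.pos-+ (#false u) (#false v) | ℤ.pos-+ (#true u) (#false u)
    = rearrange k (+ #true u) (+ #false u) (+ #false v)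

Cut-assoc : ∀ u v → AssocPartition (Cut u v) (toPartition (u ++ v))
Cut-assoc u v =
  toPartition-isPartition (u ++ v) , #true u , #false v ,
  HasCard-resp (≐-sym (Pos-Cut u v))
    (positives u , positives-unique u , ∈-positives⇔ u , length-positives u) ,
  HasCard-resp (≐-sym (Neg-Cut u v)) (holes v , holes-unique v , ∈-holes⇔ v , length-holes v) ,
  Maya-toPartition-++ u v


-- The word of a partition

toWord : List ℕ → List Bool
toWord []       = []
toWord (x ∷ xs) = true ∷ falses (x ∸ part xs 0) ++ toWord xs

toPartition-falses-++ : ∀ n w → toPartition (falses n ++ w) ≡ toPartition w
toPartition-falses-++ zero    w = refl
toPartition-falses-++ (suc n) w = toPartition-falses-++ n w

#false-toWord : ∀ xs → IsPartition xs → #false (toWord xs) ≡ part xs 0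
#false-toWord []       _ = refl
#false-toWord (x ∷ xs) p = begin
  #false (falses d ++ toWord xs)            ≡⟨ #false-++ (falses d) (toWord xs) ⟩
  #false (falses d) ℕ.+ #false (toWord xs)
    ≡⟨ cong₂ ℕ._+_ (#false-falses d) (#false-toWord xs (IsPartition-tail p)) ⟩
  d ℕ.+ part xs 0                           ≡⟨ ℕ.m∸n+n≡m (IsPartition-head≥ p) ⟩
  x                                         ∎
  where
  d = x ∸ part xs 0
  open ≡.≡-Reasoning

toPartition-toWord : ∀ xs → IsPartition xs → toPartition (toWord xs) ≡ xs
toPartition-toWord []             _ = refl
toPartition-toWord (suc x ∷ xs) p@(_ , s≤s z≤n ∷ _) =
  cong₂ cons⁺ (#false-toWord (suc x ∷ xs) p)
    (trans (toPartition-falses-++ (suc x ∸ part xs 0) (toWord xs))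
           (toPartition-toWord xs (IsPartition-tail p)))

#true-take≡#false-drop : ∀ w → #true (take (#false w) w) ≡ #false (drop (#false w) w)
#true-take≡#false-drop w = ℕ.+-cancelʳ-≡ (#false u) _ _ (begin
  #true u ℕ.+ #false u    ≡⟨ sym (length≡#true+#false u) ⟩
  length u                ≡⟨ length-take n w ⟩
  n ℕ.⊓ length w          ≡⟨ ℕ.m≤n⇒m⊓n≡m (#false≤length w) ⟩
  n                       ≡⟨ cong #false (sym (take++drop≡id n w)) ⟩
  #false (u ++ v)         ≡⟨ #false-++ u v ⟩
  #false u ℕ.+ #false v   ≡⟨ ℕ.+-comm (#false u) (#false v) ⟩
  #false v ℕ.+ #false u   ∎)
  where
  n = #false w
  u = take n w
  v = drop n w
  open ≡.≡-Reasoning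

falses⊎last-true : ∀ u → u ≡ falses (length u) ⊎ ∃[ α ] ∃[ a ] u ≡ α ++ true ∷ falses a
falses⊎last-true [] = inj₁ refl
falses⊎last-true (c ∷ u) with falses⊎last-true u
... | inj₂ (α , a , u≡) = inj₂ (c ∷ α , a , cong (c ∷_) u≡)
... | inj₁ u≡falses with c
...   | true  = inj₂ ([] , length u , cong (true ∷_) u≡falses)
...   | false = inj₁ (cong (false ∷_) u≡falses)

trues⊎first-false : ∀ v → v ≡ trues (length v) ⊎ ∃[ b ] ∃[ β ] v ≡ trues b ++ false ∷ β
trues⊎first-false []          = inj₁ refl
trues⊎first-false (false ∷ v) = inj₂ (0 , v , refl)
trues⊎first-false (true ∷ v) with trues⊎first-false v
... | inj₁ v≡trues       = inj₁ (cong (true ∷_) v≡trues)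
... | inj₂ (b , β , v≡) = inj₂ (suc b , β , cong (true ∷_) v≡)

split-at-cut : ∀ u v → 0 ℕ.< #true u → #true u ≡ #false v →
  ∃[ α ] ∃[ a ] ∃[ b ] ∃[ β ] u ≡ α ++ true ∷ falses a × v ≡ trues b ++ false ∷ β
split-at-cut u v 0<#true charge with falses⊎last-true u | trues⊎first-false v
... | inj₁ u≡falses | _ =
  ⊥-elim (ℕ.<-irrefl (sym (trans (cong #true u≡falses) (#true-falses (length u)))) 0<#true)
... | inj₂ _ | inj₁ v≡trues =
  ⊥-elim (ℕ.<-irrefl (sym (trans charge (trans (cong #false v≡trues) (#false-trues (length v))))) 0<#true)
... | inj₂ (α , a , u≡) | inj₂ (b , β , v≡) = α , a , b , β , u≡ , v≡

cut-decomposition : ∀ {x xs} → IsPartition (x ∷ xs) →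
  ∃[ α ] ∃[ a ] ∃[ b ] ∃[ β ]
    x ∷ xs ≡ toPartition ((α ++ true ∷ falses a) ++ trues b ++ false ∷ β)
    × #true (α ++ true ∷ falses a) ≡ #false (trues b ++ false ∷ β)
cut-decomposition {zero}  (_ , () ∷ _)
cut-decomposition {suc x} {xs} p = case split-at-cut u v 0<#true charge of λ where
    (α , a , b , β , u≡ , v≡) →
      α , a , b , β ,
      trans μ≡ (cong toPartition (cong₂ _++_ u≡ v≡)) ,
      subst₂ (λ u′ v′ → #true u′ ≡ #false v′) u≡ v≡ charge
  where
  w = toWord (suc x ∷ xs)
  u = take (#false w) w
  v = drop (#false w) w
  μ≡ : suc x ∷ xs ≡ toPartition (u ++ v)
  μ≡ = sym (trans (cong toPartition (take++drop≡id (#false w) w)) (toPartition-toWord _ p))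
  charge : #true u ≡ #false v
  charge = #true-take≡#false-drop w
  0<#true : 0 ℕ.< #true u
  0<#true = subst (λ n → 0 ℕ.< #true (take n w)) (sym (#false-toWord (suc x ∷ xs) p)) (s≤s z≤n)


-- Flipping the letters next to the cut

-- In U c ++ V d the letters c and d decide membership of a + ½ and -b - ½, which
-- for c = true and d = false are min S⁺ and max S⁻.
module Exchange (α : List Bool) (a b : ℕ) (β : List Bool) where

  U V : Bool → List Bool
  U c = α ++ c ∷ falses a
  V d = trues b ++ d ∷ β

  shape : Bool → Bool → List ℕ
  shape c d = toPartition (U c ++ V d)

  Cut-flipᵘ : ∀ v → Cut (U true) v ≐ insert (Cut (U false) v) (+ a)
  Cut-flipᵘ v k = ⇔.trans (Above-U k ⊎-⇔ ⇔.refl) (mk⇔ exchange exchange)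
    where
    Above-U : Above (U true) ≐ insert (Above (U false)) (+ a)
    Above-U = subst (λ n → Above (U true) ≐ insert (Above (U false)) (+ n))
                    (length-replicate a) (Above-flip α (falses a))
    exchange : ∀ {A B C : Set} → (A ⊎ B) ⊎ C → (A ⊎ C) ⊎ B
    exchange = [ [ inj₁ ∘ inj₁ , inj₂ ] , inj₁ ∘ inj₂ ]

  Cut-flipᵛ : ∀ u → Cut u (V true) ≐ insert (Cut u (V false)) -[1+ b ]
  Cut-flipᵛ u k = ⇔.trans (⇔.refl ⊎-⇔ Below-V k) (mk⇔ assocˡ assocʳ)
    where
    Below-V : Below (V true) ≐ insert (Below (V false)) -[1+ b ]
    Below-V = subst (λ n → Below (V true) ≐ insert (Below (V false)) -[1+ n ])
                    (length-replicate b) (Below-flip (trues b) β)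

  +a∉ : ∀ v → ¬ Cut (U false) v (+ a)
  +a∉ v = [ subst (λ n → ¬ Above (U false) (+ n)) (length-replicate a) (Above-flip-∉ α (falses a))
          , (λ a∈v → ℤ.≤⇒≯ (+≤+ z≤n) (Below-negative v a∈v)) ]

  -[1+b]∉ : ∀ u → ¬ Cut u (V false) -[1+ b ]
  -[1+b]∉ u = [ (λ b∈u → ℤ.≤⇒≯ (Above-nonnegative u b∈u) -<+)
              , subst (λ n → ¬ Below (V false) -[1+ n ]) (length-replicate b) (Below-flip-∉ (trues b) β) ]

  Cut-min : ∀ v → IsMinPos (Cut (U true) v) (+ a)
  Cut-min v =
    (from (Cut-flipᵘ v (+ a)) (inj₂ refl) , +≤+ z≤n) , λ x x∈ → a≤ (to (Pos-Cut (U true) v x) x∈)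
    where
    a≤ : ∀ {x} → Above (U true) x → + a ℤ.≤ x
    a≤ x∈ with Above-++-lower α (true ∷ falses a) x∈
    ... | inj₁ (inj₁ (refl , _)) = ℤ.≤-reflexive (cong +_ (sym (length-replicate a)))
    ... | inj₁ (inj₂ x∈falses)   = ⊥-elim (Above-falses a x∈falses)
    ... | inj₂ a<x               =
      ℤ.≤-trans (+≤+ (ℕ.m≤n⇒m≤1+n (ℕ.≤-reflexive (sym (length-replicate a))))) a<x

  Cut-max : ∀ u → IsMaxNeg (Cut u (V false)) -[1+ b ]
  Cut-max u = (-[1+b]∉ u , -<+) , ≤-[1+b]
    where
    ≤-[1+b] : ∀ x → Neg (Cut u (V false)) x → x ℤ.≤ -[1+ b ]
    ≤-[1+b] (+ n)    (_ , +<+ ())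
    ≤-[1+b] -[1+ j ] (x∉ , _) with j ℕ.<? b
    ... | yes j<b = ⊥-elim (x∉ (inj₂ (Below-trues b (false ∷ β) j j<b)))
    ... | no  j≮b = -≤- (ℕ.≮⇒≥ j≮b)

  size-exchange :
    + size (shape false false) - + size (shape true false)
      + + size (shape true true) - + size (shape false true) ≡ -1ℤ
  size-exchange = alternating-sum≡-1 {size (shape false false)} {size (shape true false)} (begin
    size (shape false false) ℕ.+ size (shape true true) ℕ.+ 1
      ≡⟨ cong₂ (λ p r → p ℕ.+ r ℕ.+ 1) (size-shape false false) (size-shape true true) ⟩
    inversions (w false false) ℕ.+ inversions (w true true) ℕ.+ 1
      ≡⟨ inversions-exchange α (falses a ++ trues b) β ⟩
    inversions (w true false) ℕ.+ inversions (w false true)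
      ≡⟨ cong₂ ℕ._+_ (size-shape true false) (size-shape false true) ⟨
    size (shape true false) ℕ.+ size (shape false true)
      ∎)
    where
    open ≡.≡-Reasoning
    w : Bool → Bool → List Bool
    w c d = α ++ c ∷ (falses a ++ trues b) ++ d ∷ β
    size-shape : ∀ c d → size (shape c d) ≡ inversions (w c d)
    size-shape c d = trans (size-toPartition (U c ++ V d)) (cong inversions (begin
      (α ++ c ∷ falses a) ++ trues b ++ d ∷ β   ≡⟨ ++-assoc α (c ∷ falses a) (V d) ⟩
      α ++ c ∷ falses a ++ trues b ++ d ∷ β
        ≡⟨ cong (λ y → α ++ c ∷ y) (++-assoc (falses a) (trues b) (d ∷ β)) ⟨
      w c d                                     ∎))

  module _ (charge : #true (U true) ≡ #false (V false)) where

    S : HSet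
    S = Maya (shape true false)

    S≐ : S ≐ Cut (U true) (V false)
    S≐ k = subst (λ j → S k ⇔ Cut (U true) (V false) j) k+0≡k (Maya-toPartition-++ (U true) (V false) k)
      where
      k+0≡k : k + (+ #true (U true) - + #false (V false)) ≡ k
      k+0≡k = trans (cong (λ j → k + j) (ℤ.i≡j⇒i-j≡0 (cong +_ charge))) (ℤ.+-identityʳ k)

    r≐ : remove S (+ a) ≐ Cut (U false) (V false)
    r≐ = ≐-trans (remove-cong (+ a) (≐-trans S≐ (Cut-flipᵘ (V false)))) (remove-insert (+a∉ (V false)))

    c≐ : insert S -[1+ b ] ≐ Cut (U true) (V true)
    c≐ = ≐-trans (insert-cong -[1+ b ] S≐) (≐-sym (Cut-flipᵛ (U true)))

    rc≐ : insert (remove S (+ a)) -[1+ b ] ≐ Cut (U false) (V true)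
    rc≐ = ≐-trans (insert-cong -[1+ b ] r≐) (≐-sym (Cut-flipᵛ (U false)))

    S-min : IsMinPos S (+ a)
    S-min = IsMinPos-resp (≐-sym S≐) (Cut-min (V false))

    S-max : IsMaxNeg S -[1+ b ]
    S-max = IsMaxNeg-resp (≐-sym S≐) (Cut-max (U true))

    r-shape : AssocPartition (remove S (+ a)) (shape false false)
    r-shape = AssocPartition-resp (≐-sym r≐) (Cut-assoc (U false) (V false))

    c-shape : AssocPartition (insert S -[1+ b ]) (shape true true)
    c-shape = AssocPartition-resp (≐-sym c≐) (Cut-assoc (U true) (V true))

    rc-shape : AssocPartition (insert (remove S (+ a)) -[1+ b ]) (shape false true)
    rc-shape = AssocPartition-resp (≐-sym rc≐) (Cut-assoc (U false) (V true))

    RC-Data-shape :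
      RC-Data (shape true false) (+ a) -[1+ b ] (shape false false) (shape true true) (shape false true)
    RC-Data-shape = S-min , S-max , r-shape , c-shape , rc-shape

    RC-Data-unique : ∀ {m₁ m₂ r c rc} → RC-Data (shape true false) m₁ m₂ r c rc →
      r ≡ shape false false × c ≡ shape true true × rc ≡ shape false true
    RC-Data-unique (min , max , r-assoc , c-assoc , rc-assoc)
      with IsMinPos-unique min S-min | IsMaxNeg-unique max S-max
    ... | refl | refl =
      AssocPartition-unique r-assoc r-shape ,
      AssocPartition-unique c-assoc c-shape ,
      AssocPartition-unique rc-assoc rc-shape


lemma5p29 : (μ : List ℕ) → IsPartition μ → (x : ℕ) → (xs : List ℕ) → μ ≡ x ∷ xs →
    (∃[ m₁ ] ∃[ m₂ ] ∃[ r ] ∃[ c ] ∃[ rc ] RC-Data μ m₁ m₂ r c rc)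
    × (∀ m₁ m₂ r c rc → RC-Data μ m₁ m₂ r c rc →
        + size r - + size μ + + size c - + size rc ≡ -1ℤ)
lemma5p29 μ μ-partition x xs μ≡x∷xs
  with cut-decomposition (subst IsPartition μ≡x∷xs μ-partition)
... | α , a , b , β , x∷xs≡ , charge with trans μ≡x∷xs x∷xs≡
... | refl =
  (_ , _ , _ , _ , _ , RC-Data-shape charge) ,
  λ _ _ r c rc rc-data → case RC-Data-unique charge rc-data of λ where
    (refl , refl , refl) → size-exchange
  where open Exchange α a b β
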